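{- Let $m$ be an even positive integer and let $r$ be a positive integer with $r<m/2$ and $\gcd(r,m)=1$. For every $b\in\mathbb{F}_{2^m}^*$, the function $f_{b,0,r}:\mathbb{F}_{2^m}\times\mathbb{F}_{2^m}\to\mathbb{F}_{2^m}\times\mathbb{F}_{2^m}$ given by \[ f_{b,0,r}(x,y)=\big(xy,\; x^{2^r+1}+x^{2^{r+m/2}}y^{2^{m/2}}+bxy^{2^r}\big) \] is not APN.
   Context: A function $f:V\to V$, where $V=\mathbb{F}_{2^m}\times\mathbb{F}_{2^m}$ with componentwise addition, is called almost perfect nonlinear (APN) if for every nonzero $a\in V$ and every $\beta\in V$ the equation $f(z+a)+f(z)=\beta$ has at most two solutions $z\in V$. -}

module Defs where

open import Level using (0ℓ)
open import Data.Nat as ℕ using (ℕ; zero; suc)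
open import Data.Fin using (Fin)
open import Data.Product using (_×_; _,_; ∃)
open import Relation.Binary.PropositionalEquality using (_≡_; _≢_)
open import Relation.Nullary using (¬_)
open import Algebra.Structures using (IsCommutativeRing)
open import Function.Bundles using (_↔_)

-- All such fields are
-- isomorphic, so quantifying over them is the same as fixing F_{2^m}.
record FiniteField (m : ℕ) : Set₁ where
  infixl 6 _+_
  infixl 7 _*_
  field
    Carrier : Set
    _+_ _*_ : Carrier → Carrier → Carrier
    -_      : Carrier → Carrier
    0# 1#   : Carrier
    isCommutativeRing : IsCommutativeRing _≡_ _+_ _*_ -_ 0# 1#
    0≢1     : 0# ≢ 1#
    inverse : ∀ x → x ≢ 0# → ∃ λ y → x * y ≡ 1#
    card    : Carrier ↔ Fin (2 ℕ.^ m)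

  _^_ : Carrier → ℕ → Carrier
  x ^ zero  = 1#
  x ^ suc n = x * (x ^ n)

  V : Set
  V = Carrier × Carrier

  _⊕_ : V → V → V
  (a₁ , a₂) ⊕ (b₁ , b₂) = (a₁ + b₁ , a₂ + b₂)

  0V : V
  0V = (0# , 0#)

  IsAPN : (V → V) → Set
  IsAPN f = ∀ (a β : V) → a ≢ 0V → ∀ (z₁ z₂ z₃ : V) →
    f (z₁ ⊕ a) ⊕ f z₁ ≡ β → f (z₂ ⊕ a) ⊕ f z₂ ≡ β → f (z₃ ⊕ a) ⊕ f z₃ ≡ β →
    ¬ (z₁ ≢ z₂ × z₁ ≢ z₃ × z₂ ≢ z₃)

  fb0r : (h r : ℕ) → Carrier → V → V
  fb0r h r b (x , y) =
    ( x * y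
    , x ^ (2 ℕ.^ r ℕ.+ 1) + (x ^ (2 ℕ.^ (r ℕ.+ h))) * (y ^ (2 ℕ.^ h)) + b * x * (y ^ (2 ℕ.^ r)) )

{-# OPTIONS --safe #-}
module Submission where

open import Defs
open import Data.Nat as ℕ using (ℕ; _<_; _≤_; _/_; s≤s; z≤n; >-nonZero)
open import Data.Nat.Properties using (≤-trans; ^-monoʳ-≤; m≤n+m; m^n>0)
open import Data.Nat.Divisibility using (_∣_; ∣⇒≤)
open import Data.Nat.GCD using (gcd)
open import Data.Fin using (Fin; zero; suc)
open import Data.Fin.Properties using (inject≤-injective)
open import Data.Product using (_,_; proj₂)
open import Function.Bundles using (_↣_; mk↣; Injection)
open import Function.Construct.Composition using (_↣-∘_)
open import Function.Properties.Inverse using (↔⇒↣; ↔-sym)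
open import Relation.Binary.PropositionalEquality
open import Relation.Nullary using (¬_)
open import Algebra.Structures using (IsCommutativeRing)

-- f_{b,0,r} vanishes on the line x = 0, so its derivative in direction (0,1)
-- is zero at every point of that line: 2^m ≥ 3 solutions where APN allows two.

3≤2^m : ∀ {m} → 0 < m → 2 ∣ m → 3 ≤ 2 ℕ.^ m
3≤2^m 0<m 2∣m = ≤-trans (s≤s (s≤s (s≤s z≤n))) (^-monoʳ-≤ 2 (∣⇒≤ {{>-nonZero 0<m}} 2∣m))

Fin-↣ : ∀ {k n} → k ≤ n → Fin k ↣ Fin n
Fin-↣ k≤n = mk↣ (inject≤-injective k≤n k≤n _ _)

module _ {m : ℕ} (F : FiniteField m) where
  open FiniteField F
  open IsCommutativeRing isCommutativeRing using (zeroˡ; zeroʳ; +-identityˡ)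

  3≤2^m⇒Fin3↣Carrier : 3 ≤ 2 ℕ.^ m → Fin 3 ↣ Carrier
  3≤2^m⇒Fin3↣Carrier 3≤2^m = ↔⇒↣ (↔-sym card) ↣-∘ Fin-↣ 3≤2^m

  0^n≡0 : ∀ {n} → 0 < n → 0# ^ n ≡ 0#
  0^n≡0 (s≤s _) = zeroˡ _

  fb0r-vanishes-on-x≡0 : ∀ h r b y → fb0r h r b (0# , y) ≡ 0V
  fb0r-vanishes-on-x≡0 h r b y = cong₂ _,_ (zeroˡ y) (begin
      0# ^ (2 ℕ.^ r ℕ.+ 1) + 0# ^ (2 ℕ.^ (r ℕ.+ h)) * Y + b * 0# * Y′
    ≡⟨ cong₂ (λ u v → u + v * Y + b * 0# * Y′)
         (0^n≡0 (m≤n+m 1 (2 ℕ.^ r))) (0^n≡0 (m^n>0 2 (r ℕ.+ h))) ⟩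
      0# + 0# * Y + b * 0# * Y′
    ≡⟨ cong₂ (λ u v → 0# + u + v * Y′) (zeroˡ Y) (zeroʳ b) ⟩
      0# + 0# + 0# * Y′
    ≡⟨ cong₂ _+_ (+-identityˡ 0#) (zeroˡ Y′) ⟩
      0# + 0#
    ≡⟨ +-identityˡ 0# ⟩
      0# ∎)
    where
    open ≡-Reasoning
    Y Y′ : Carrier
    Y = y ^ (2 ℕ.^ h)
    Y′ = y ^ (2 ℕ.^ r)

  constant-on-x≡0⇒¬APN : Fin 3 ↣ Carrier → (f : V → V) (c : V) →
    (∀ y → f (0# , y) ≡ c) → ¬ IsAPN f
  constant-on-x≡0⇒¬APN ι f c f≡c apn =
    apn (0# , 1#) (c ⊕ c) 0,1≢0 (point zero) (point (suc zero)) (point (suc (suc zero)))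
      (derivative≡c⊕c _) (derivative≡c⊕c _) (derivative≡c⊕c _)
      (point-injective (λ ()) , point-injective (λ ()) , point-injective (λ ()))
    where
    open Injection ι using (to; injective)

    0,1≢0 : (0# , 1#) ≢ 0V
    0,1≢0 eq = 0≢1 (sym (cong proj₂ eq))

    point : Fin 3 → V
    point i = (0# , to i)

    point-injective : ∀ {i j} → i ≢ j → point i ≢ point j
    point-injective i≢j eq = i≢j (injective (cong proj₂ eq))

    derivative≡c⊕c : ∀ y → f ((0# , y) ⊕ (0# , 1#)) ⊕ f (0# , y) ≡ c ⊕ c
    derivative≡c⊕c y = cong₂ _⊕_
      (trans (cong (λ x → f (x , y + 1#)) (+-identityˡ 0#)) (f≡c (y + 1#)))
      (f≡c y)

theorem3p3 : (m : ℕ) → 0 < m → 2 ∣ m → (r : ℕ) → 0 < r → r < m / 2 → gcd r m ≡ 1 →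
    (F : FiniteField m) → (b : FiniteField.Carrier F) → b ≢ FiniteField.0# F →
    ¬ FiniteField.IsAPN F (FiniteField.fb0r F (m / 2) r b)
theorem3p3 m 0<m 2∣m r _ _ _ F b _ =
  constant-on-x≡0⇒¬APN F (3≤2^m⇒Fin3↣Carrier F (3≤2^m 0<m 2∣m)) (fb0r (m / 2) r b) 0V
    (fb0r-vanishes-on-x≡0 F (m / 2) r b)
  where open FiniteField F using (fb0r; 0V)
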